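{- For every $n\ge 4$, $D^s_f(Q_n;Q_1)\le n+1$.
   Context: The $n$-dimensional hypercube $Q_n$ is the graph whose vertices are the binary strings of length $n$, two vertices being adjacent iff they differ in exactly one position; $Q_1\cong K_2$. The diameter of a graph is the maximum graph distance between two of its vertices. For a graph $G$ and a graph $W$, a $W$-substructure in $G$ is a subgraph of $G$ isomorphic to a connected subgraph of $W$; removing a family of subgraphs means deleting all their vertices. $\kappa^s(G;W)$ is the minimum number $t$ such that there exist $t$ pairwise vertex-disjoint $W$-substructures whose removal disconnects $G$. $D^s_f(G;W)$ is the maximum diameter of a graph obtained from $G$ by removing at most $\kappa^s(G;W)-1$ pairwise vertex-disjoint $W$-substructures. -}

module Defs where

open import Data.Nat using (ℕ; zero; suc; _+_; _<_)
open import Data.Bool using (Bool; _xor_; if_then_else_)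
open import Data.Vec using (Vec; []; _∷_)
open import Data.List using (List; length)
open import Data.List.Relation.Unary.Any using (Any)
open import Data.List.Relation.Unary.AllPairs using (AllPairs)
open import Data.Product using (_×_; ∃; ∃-syntax)
open import Data.Sum using (_⊎_)
open import Data.Empty using (⊥)
open import Relation.Nullary using (¬_)
open import Relation.Binary.PropositionalEquality using (_≡_)

Vertex : ℕ → Set
Vertex n = Vec Bool n

hamming : ∀ {n} → Vertex n → Vertex n → ℕ
hamming [] [] = 0
hamming (x ∷ xs) (y ∷ ys) = (if x xor y then 1 else 0) + hamming xs ys

Adj : ∀ {n} → Vertex n → Vertex n → Set
Adj u v = hamming u v ≡ 1

-- A Q_1-substructure of Q_n: a subgraph isomorphic to a connected subgraph
-- of Q_1 ≅ K_2, i.e. a single vertex (K_1) or an edge (K_2).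
data Q1Sub (n : ℕ) : Set where
  vtx  : Vertex n → Q1Sub n
  edge : (u v : Vertex n) → Adj u v → Q1Sub n

_∈S_ : ∀ {n} → Vertex n → Q1Sub n → Set
x ∈S vtx u = x ≡ u
x ∈S edge u v _ = x ≡ u ⊎ x ≡ v

VDisjoint : ∀ {n} → Q1Sub n → Q1Sub n → Set
VDisjoint s t = ∀ x → x ∈S s → x ∈S t → ⊥

PairwiseDisjoint : ∀ {n} → List (Q1Sub n) → Set
PairwiseDisjoint F = AllPairs VDisjoint F

Removed : ∀ {n} → List (Q1Sub n) → Vertex n → Set
Removed F x = Any (x ∈S_) F

data Walk {n : ℕ} (F : List (Q1Sub n)) : Vertex n → Vertex n → ℕ → Set where
  here : ∀ {u} → ¬ Removed F u → Walk F u u 0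
  step : ∀ {u v w k} → ¬ Removed F u → Adj u v → Walk F v w k → Walk F u w (suc k)

Disconnects : ∀ {n} → List (Q1Sub n) → Set
Disconnects {n} F =
  ∃[ u ] ∃[ v ] (¬ Removed F u × ¬ Removed F v × ¬ (∃[ k ] Walk F u v k))

IsKappaS : (n : ℕ) → ℕ → Set
IsKappaS n t =
  (∃[ F ] (PairwiseDisjoint {n} F × length F ≡ t × Disconnects F))
  × (∀ (F : List (Q1Sub n)) → PairwiseDisjoint F → length F < t → ¬ Disconnects F)

module Submission where

-- If at most d − 2 members meet the subcube spanned by
-- u and v, where d = dist(u, v), some geodesic from u to v survives: a member contains at most one
-- neighbour of u, so two neighbours of u towards v survive, and one of them can be chosen so that some
-- member meeting the subcube misses the facet from that neighbour to v.
-- For the diameter bound, induct on a subcube of dimension m that contains u and v and is met by at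
-- most m − 2 members, and take a free coordinate k on which u and v agree.  If the k-neighbour of u or
-- of v is removed, fixing coordinate k loses one dimension and at least one member.  Otherwise there
-- is a detour of length d + 2 through both k-neighbours, inside the translate of the subcube spanned by
-- u and v; these translates are pairwise at distance ≥ 2, so they cannot all be crowded.
-- Finally κ ≤ n − 1, because n − 1 edges cut the edge between 0…0 and 10…0 off from the rest.

open import Defs
open import Data.Bool using (true; false; not; _xor_; if_then_else_)
open import Data.Bool.Properties using (not-involutive; not-¬; ¬-not; xor-comm) renaming (_≟_ to _≟ᵇ_)
open import Data.Empty using (⊥; ⊥-elim)
open import Data.Fin using (Fin; zero; suc; _≟_)
open import Data.Fin.Properties using () renaming (suc-injective to suc-injectiveᶠ; any? to anyᶠ?)
open import Data.Fin.Subset using (Subset; _∈_; _∉_; _⊆_; ∣_∣; _─_; _-_; ⁅_⁆)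
open import Data.Fin.Subset.Properties
  using ( _∈?_; _⊆?_; drop-there; x∈⁅x⁆; ∣⁅x⁆∣≡1; ⊆⊤; ∣⊤∣≡n; p─q⊆p; p⊆q⇒∣p∣≤∣q∣; ∣p∣≤∣x∷p∣
        ; x∈p⇒∣p-x∣<∣p∣; x∈p∧x≢y⇒x∈p-y )
open import Data.List using (List; []; _∷_; length; map; tabulate)
open import Data.List.Properties using (length-map; length-tabulate)
open import Data.List.Membership.Propositional using (find; lose) renaming (_∈_ to _∈ₗ_)
open import Data.List.Relation.Unary.All as All using (All; []; _∷_)
import Data.List.Relation.Unary.All.Properties as All
open import Data.List.Relation.Unary.AllPairs as AllPairs using (AllPairs; []; _∷_)
import Data.List.Relation.Unary.AllPairs.Properties as AllPairs
open import Data.List.Relation.Unary.Any using (Any; here; there; any?)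
import Data.List.Relation.Unary.Any.Properties as Any
open import Data.List.Relation.Unary.Unique.Propositional using (Unique)
import Data.List.Relation.Unary.Unique.Propositional.Properties as Unique
open import Data.Nat using (ℕ; zero; suc; _+_; _*_; _∸_; _≤_; _<_; z≤n; s≤s; _≤?_; _<?_)
open import Data.Nat.ListAction using (sum)
open import Data.Nat.Properties
  using ( ≤-refl; ≤-reflexive; ≤-trans; ≤-antisym; ≤-pred; <-≤-trans; ≤⇒≯; ≮⇒≥; ≰⇒>; n≤1+n; n<1+n
        ; m≤n⇒m≤1+n; m<n⇒m<1+n; m≤n+m; m+n≮n; suc-injective; +-suc; +-comm; +-identityʳ
        ; +-mono-≤; +-monoˡ-≤; +-monoʳ-≤; +-cancelˡ-≤; +-cancelʳ-≤; +-cancelˡ-<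
        ; ∸-monoˡ-≤; ∸-+-assoc; m+[n∸m]≡n; +-commutativeSemigroup; module ≤-Reasoning )
open import Algebra.Properties.CommutativeSemigroup +-commutativeSemigroup using (x∙yz≈y∙xz)
open import Data.Nat.Tactic.RingSolver using (solve-∀)
open import Data.Product using (_×_; _,_; proj₁; proj₂; ∃-syntax)
open import Data.Sum using (_⊎_; inj₁; inj₂; [_,_]; [_,_]′; map₂)
open import Data.Vec using (_∷_; []; here; there; lookup; updateAt; zipWith; replicate; tail)
open import Data.Vec.Properties
  using (≡-dec; lookup∘updateAt; lookup∘updateAt′; updateAt-updateAt; updateAt-id-local)
open import Function using (_∘_; id; flip; case_of_)
open import Level using (Level)
open import Relation.Binary.PropositionalEquality
  using (_≡_; _≢_; refl; sym; trans; cong; subst; module ≡-Reasoning)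
open import Relation.Nullary using (¬_; yes; no; does)
open import Relation.Nullary.Decidable using (Dec; map′; _×-dec_; _⊎-dec_; ¬?; decidable-stable)
open import Relation.Unary using (Pred; Decidable)

module _ {a} {A : Set a} where

  private
    variable
      ℓ : Level
      P Q : Pred A ℓ

  count : Decidable P → List A → ℕ
  count P? []       = 0
  count P? (x ∷ xs) = if does (P? x) then suc (count P? xs) else count P? xs

  count≤length : (P? : Decidable P) (xs : List A) → count P? xs ≤ length xs
  count≤length P? []       = z≤n
  count≤length P? (x ∷ xs) with P? x
  ... | yes _ = s≤s (count≤length P? xs)
  ... | no  _ = m≤n⇒m≤1+n (count≤length P? xs)

  count-mono : (P? : Decidable P) (Q? : Decidable Q) → (∀ {x} → P x → Q x) →
               ∀ xs → count P? xs ≤ count Q? xs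
  count-mono P? Q? P⇒Q []       = z≤n
  count-mono P? Q? P⇒Q (x ∷ xs) with P? x | Q? x
  ... | yes _ | yes _ = s≤s (count-mono P? Q? P⇒Q xs)
  ... | no  _ | yes _ = m≤n⇒m≤1+n (count-mono P? Q? P⇒Q xs)
  ... | no  _ | no  _ = count-mono P? Q? P⇒Q xs
  ... | yes p | no ¬q = ⊥-elim (¬q (P⇒Q p))

  count-mono-< : (P? : Decidable P) (Q? : Decidable Q) → (∀ {x} → P x → Q x) →
                 ∀ {xs} → Any (λ x → Q x × ¬ P x) xs → count P? xs < count Q? xs
  count-mono-< P? Q? P⇒Q {x ∷ xs} (here (q , ¬p)) with P? x | Q? x
  ... | yes p | _     = ⊥-elim (¬p p)
  ... | no  _ | yes _ = s≤s (count-mono P? Q? P⇒Q xs)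
  ... | no  _ | no ¬q = ⊥-elim (¬q q)
  count-mono-< P? Q? P⇒Q {x ∷ xs} (there any) with P? x | Q? x
  ... | yes _ | yes _ = s≤s (count-mono-< P? Q? P⇒Q any)
  ... | no  _ | yes _ = m<n⇒m<1+n (count-mono-< P? Q? P⇒Q any)
  ... | no  _ | no  _ = count-mono-< P? Q? P⇒Q any
  ... | yes p | no ¬q = ⊥-elim (¬q (P⇒Q p))

  Any⇒0<count : (P? : Decidable P) → ∀ {xs} → Any P xs → 0 < count P? xs
  Any⇒0<count P? {x ∷ xs} (here p) with P? x
  ... | yes _ = s≤s z≤n
  ... | no ¬p = ⊥-elim (¬p p)
  Any⇒0<count P? {x ∷ xs} (there any) with P? x
  ... | yes _ = s≤s z≤n
  ... | no  _ = Any⇒0<count P? any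

  0<count⇒Any : (P? : Decidable P) → ∀ xs → 0 < count P? xs → Any P xs
  0<count⇒Any P? (x ∷ xs) pos with P? x
  ... | yes p = here p
  ... | no  _ = there (0<count⇒Any P? xs pos)

  count+count∁≡length : (P? : Decidable P) → ∀ xs → count P? xs + count (¬? ∘ P?) xs ≡ length xs
  count+count∁≡length P? []       = refl
  count+count∁≡length P? (x ∷ xs) with P? x
  ... | yes _ = cong suc (count+count∁≡length P? xs)
  ... | no  _ = trans (+-suc _ _) (cong suc (count+count∁≡length P? xs))

  count+count-∖ : (P? : Decidable P) (Q? : Decidable Q) → (∀ {x} → P x → Q x) →
                  ∀ xs → count P? xs + count (λ x → Q? x ×-dec ¬? (P? x)) xs ≡ count Q? xs
  count+count-∖ P? Q? P⇒Q []       = refl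
  count+count-∖ P? Q? P⇒Q (x ∷ xs) with P? x | Q? x
  ... | yes _ | yes _ = cong suc (count+count-∖ P? Q? P⇒Q xs)
  ... | no  _ | yes _ = trans (+-suc _ _) (cong suc (count+count-∖ P? Q? P⇒Q xs))
  ... | no  _ | no  _ = count+count-∖ P? Q? P⇒Q xs
  ... | yes p | no ¬q = ⊥-elim (¬q (P⇒Q p))

  sum-count≤count : ∀ {i} {I : Set i} {R : I → Pred A ℓ} (R? : ∀ j → Decidable (R j)) (Q? : Decidable Q) →
                    ∀ js → AllPairs (λ j k → ∀ {x} → R j x → R k x → ⊥) js → All (λ j → ∀ {x} → R j x → Q x) js →
                    ∀ xs → sum (map (λ j → count (R? j) xs) js) ≤ count Q? xs
  sum-count≤count R? Q? []       _                _              xs = z≤n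
  sum-count≤count {Q = Q} {R = R} R? Q? (j ∷ js) (apart ∷ apart′) (R⇒Q ∷ R⇒Q′) xs = begin
    count (R? j) xs + sum (map (λ k → count (R? k) xs) js)
      ≤⟨ +-monoʳ-≤ (count (R? j) xs) (sum-count≤count R? (λ x → Q? x ×-dec ¬? (R? j x)) js apart′ R⇒Q∖Rj xs) ⟩
    count (R? j) xs + count (λ x → Q? x ×-dec ¬? (R? j x)) xs
      ≡⟨ count+count-∖ (R? j) Q? R⇒Q xs ⟩
    count Q? xs ∎
    where
    open ≤-Reasoning
    avoid : ∀ {ks} → All (λ k → ∀ {x} → R j x → R k x → ⊥) ks → All (λ k → ∀ {x} → R k x → Q x) ks →
            All (λ k → ∀ {x} → R k x → Q x × ¬ R j x) ks
    avoid []                     []            = []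
    avoid (disjoint ∷ disjoint′) (R⇒Q ∷ R⇒Q″) = (λ r → R⇒Q r , λ rj → disjoint rj r) ∷ avoid disjoint′ R⇒Q″
    R⇒Q∖Rj = avoid apart R⇒Q′

  count≤sum : (P? : Decidable P) (f : A → ℕ) → (∀ {x} → P x → 1 ≤ f x) → ∀ xs → count P? xs ≤ sum (map f xs)
  count≤sum P? f P⇒1≤f []       = z≤n
  count≤sum P? f P⇒1≤f (x ∷ xs) with P? x
  ... | yes p = +-mono-≤ (P⇒1≤f p) (count≤sum P? f P⇒1≤f xs)
  ... | no  _ = ≤-trans (count≤sum P? f P⇒1≤f xs) (m≤n+m _ (f x))

  2≤count⇒distinct : (P? : Decidable P) → ∀ {xs} → Unique xs → 2 ≤ count P? xs →
                     ∃[ x ] ∃[ y ] (x ≢ y × (x ∈ₗ xs × P x) × (y ∈ₗ xs × P y))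
  2≤count⇒distinct P? {x ∷ xs} (x∉xs ∷ unique) two with P? x
  ... | yes p = let y , y∈xs , py = find (0<count⇒Any P? xs (≤-pred two))
                in x , y , All.lookup x∉xs y∈xs , (here refl , p) , (there y∈xs , py)
  ... | no  _ = let y , z , y≢z , (y∈xs , py) , (z∈xs , pz) = 2≤count⇒distinct P? unique two
                in y , z , y≢z , (there y∈xs , py) , (there z∈xs , pz)

private
  variable
    n : ℕ
    i j k : Fin n
    x y : Vertex n
    p : Subset n

x∈p⇒0<∣p∣ : i ∈ p → 0 < ∣ p ∣
x∈p⇒0<∣p∣             here        = s≤s z≤n
x∈p⇒0<∣p∣ {p = b ∷ p} (there i∈p) = ≤-trans (x∈p⇒0<∣p∣ i∈p) (∣p∣≤∣x∷p∣ b p)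

0<∣p∣⇒nonempty : ∀ (p : Subset n) → 0 < ∣ p ∣ → ∃[ i ] i ∈ p
0<∣p∣⇒nonempty (true ∷ p)  _   = zero , here
0<∣p∣⇒nonempty (false ∷ p) pos = let i , i∈p = 0<∣p∣⇒nonempty p pos in suc i , there i∈p

2≤∣p∣ : i ∈ p → j ∈ p → i ≢ j → 2 ≤ ∣ p ∣
2≤∣p∣ i∈p j∈p i≢j = ≤-trans (s≤s (x∈p⇒0<∣p∣ (x∈p∧x≢y⇒x∈p-y j∈p (i≢j ∘ sym)))) (x∈p⇒∣p-x∣<∣p∣ i∈p)

∣p∣≤∣p─q∣+∣q∣ : ∀ (p q : Subset n) → ∣ p ∣ ≤ ∣ p ─ q ∣ + ∣ q ∣
∣p∣≤∣p─q∣+∣q∣ []          []          = z≤n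
∣p∣≤∣p─q∣+∣q∣ (true ∷ p)  (true ∷ q)  = ≤-trans (s≤s (∣p∣≤∣p─q∣+∣q∣ p q)) (≤-reflexive (sym (+-suc _ _)))
∣p∣≤∣p─q∣+∣q∣ (false ∷ p) (true ∷ q)  = ≤-trans (∣p∣≤∣p─q∣+∣q∣ p q) (+-monoʳ-≤ ∣ p ─ q ∣ (n≤1+n _))
∣p∣≤∣p─q∣+∣q∣ (true ∷ p)  (false ∷ q) = s≤s (∣p∣≤∣p─q∣+∣q∣ p q)
∣p∣≤∣p─q∣+∣q∣ (false ∷ p) (false ∷ q) = ∣p∣≤∣p─q∣+∣q∣ p q

x∈p─q⁻ : ∀ (p q : Subset n) → i ∈ p ─ q → i ∈ p × i ∉ q
x∈p─q⁻            (true ∷ p)  (false ∷ q) here          = here , λ ()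
x∈p─q⁻ {i = zero} (true ∷ p)  (true ∷ q)  ()
x∈p─q⁻ {i = zero} (false ∷ p) (true ∷ q)  ()
x∈p─q⁻ {i = zero} (false ∷ p) (false ∷ q) ()
x∈p─q⁻            (b ∷ p)     (c ∷ q)     (there i∈p─q) =
  let i∈p , i∉q = x∈p─q⁻ p q i∈p─q in there i∈p , i∉q ∘ drop-there

x∉p-x : ∀ (p : Subset n) i → i ∉ p - i
x∉p-x p i i∈p-i = proj₂ (x∈p─q⁻ p ⁅ i ⁆ i∈p-i) (x∈⁅x⁆ i)

x∈p⇒1+∣p-x∣≡∣p∣ : ∀ {i} {p : Subset n} → i ∈ p → suc ∣ p - i ∣ ≡ ∣ p ∣
x∈p⇒1+∣p-x∣≡∣p∣ {i = i} {p} i∈p = ≤-antisym (x∈p⇒∣p-x∣<∣p∣ i∈p) (begin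
  ∣ p ∣                   ≤⟨ ∣p∣≤∣p─q∣+∣q∣ p ⁅ i ⁆ ⟩
  ∣ p - i ∣ + ∣ ⁅ i ⁆ ∣   ≡⟨ cong (∣ p - i ∣ +_) (∣⁅x⁆∣≡1 i) ⟩
  ∣ p - i ∣ + 1           ≡⟨ +-comm _ 1 ⟩
  suc ∣ p - i ∣           ∎)
  where open ≤-Reasoning

elements : Subset n → List (Fin n)
elements []          = []
elements (true ∷ p)  = zero ∷ map suc (elements p)
elements (false ∷ p) = map suc (elements p)

length-elements : ∀ (p : Subset n) → length (elements p) ≡ ∣ p ∣
length-elements []          = refl
length-elements (true ∷ p)  = cong suc (trans (length-map suc (elements p)) (length-elements p))
length-elements (false ∷ p) = trans (length-map suc (elements p)) (length-elements p)

elements⊆ : ∀ (p : Subset n) → All (_∈ p) (elements p)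
elements⊆ []          = []
elements⊆ (true ∷ p)  = here ∷ All.map⁺ (All.map there (elements⊆ p))
elements⊆ (false ∷ p) = All.map⁺ (All.map there (elements⊆ p))

elements-unique : ∀ (p : Subset n) → Unique (elements p)
elements-unique []          = []
elements-unique (true ∷ p)  =
  All.map⁺ (All.universal (λ _ ()) (elements p)) ∷ Unique.map⁺ suc-injectiveᶠ (elements-unique p)
elements-unique (false ∷ p) = Unique.map⁺ suc-injectiveᶠ (elements-unique p)

toggle : Fin n → Vertex n → Vertex n
toggle i x = updateAt x i not

lookup-toggle : ∀ i (x : Vertex n) → lookup (toggle i x) i ≡ not (lookup x i)
lookup-toggle i x = lookup∘updateAt i x

lookup-toggle′ : j ≢ i → ∀ (x : Vertex n) → lookup (toggle i x) j ≡ lookup x j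
lookup-toggle′ {j = j} {i = i} j≢i x = lookup∘updateAt′ j i j≢i x

toggle-involutive : ∀ i (x : Vertex n) → toggle i (toggle i x) ≡ x
toggle-involutive i x = trans (updateAt-updateAt i x) (updateAt-id-local i x (not-involutive (lookup x i)))

hamming-refl : ∀ (x : Vertex n) → hamming x x ≡ 0
hamming-refl []          = refl
hamming-refl (true ∷ x)  = hamming-refl x
hamming-refl (false ∷ x) = hamming-refl x

hamming-sym : ∀ (x y : Vertex n) → hamming x y ≡ hamming y x
hamming-sym []      []      = refl
hamming-sym (a ∷ x) (b ∷ y) rewrite xor-comm a b = cong ((if b xor a then 1 else 0) +_) (hamming-sym x y)

hamming≡0⇒≡ : ∀ (x y : Vertex n) → hamming x y ≡ 0 → x ≡ y
hamming≡0⇒≡ []          []          _  = refl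
hamming≡0⇒≡ (true ∷ x)  (true ∷ y)  eq = cong (true ∷_) (hamming≡0⇒≡ x y eq)
hamming≡0⇒≡ (false ∷ x) (false ∷ y) eq = cong (false ∷_) (hamming≡0⇒≡ x y eq)

adj-toggle : ∀ i (x : Vertex n) → Adj x (toggle i x)
adj-toggle zero    (true ∷ x)  = cong suc (hamming-refl x)
adj-toggle zero    (false ∷ x) = cong suc (hamming-refl x)
adj-toggle (suc i) (true ∷ x)  = adj-toggle i x
adj-toggle (suc i) (false ∷ x) = adj-toggle i x

adj⇒toggle : ∀ (x y : Vertex n) → Adj x y → ∃[ i ] y ≡ toggle i x
adj⇒toggle []          []          ()
adj⇒toggle (true ∷ x)  (false ∷ y) eq = zero , cong (false ∷_) (sym (hamming≡0⇒≡ x y (suc-injective eq)))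
adj⇒toggle (false ∷ x) (true ∷ y)  eq = zero , cong (true ∷_) (sym (hamming≡0⇒≡ x y (suc-injective eq)))
adj⇒toggle (true ∷ x)  (true ∷ y)  eq = let i , y≡ = adj⇒toggle x y eq in suc i , cong (true ∷_) y≡
adj⇒toggle (false ∷ x) (false ∷ y) eq = let i , y≡ = adj⇒toggle x y eq in suc i , cong (false ∷_) y≡

adj-sym : ∀ (x y : Vertex n) → Adj x y → Adj y x
adj-sym x y adj = trans (hamming-sym y x) adj

hamming-toggle-differing : ∀ i (x y : Vertex n) → lookup x i ≢ lookup y i →
                           suc (hamming (toggle i x) y) ≡ hamming x y
hamming-toggle-differing zero    (true ∷ x)  (false ∷ y) _  = refl
hamming-toggle-differing zero    (false ∷ x) (true ∷ y)  _  = refl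
hamming-toggle-differing zero    (true ∷ x)  (true ∷ y)  ne = ⊥-elim (ne refl)
hamming-toggle-differing zero    (false ∷ x) (false ∷ y) ne = ⊥-elim (ne refl)
hamming-toggle-differing (suc i) (a ∷ x)     (b ∷ y)     ne with a xor b
... | true  = cong suc (hamming-toggle-differing i x y ne)
... | false = hamming-toggle-differing i x y ne

hamming-toggle-agreeing : ∀ i (x y : Vertex n) → lookup x i ≡ lookup y i →
                          hamming (toggle i x) y ≡ suc (hamming x y)
hamming-toggle-agreeing zero    (true ∷ x)  (true ∷ y)  _  = refl
hamming-toggle-agreeing zero    (false ∷ x) (false ∷ y) _  = refl
hamming-toggle-agreeing (suc i) (a ∷ x)     (b ∷ y)     eq with a xor b
... | true  = cong suc (hamming-toggle-agreeing i x y eq)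
... | false = hamming-toggle-agreeing i x y eq

Δ : Vertex n → Vertex n → Subset n
Δ = zipWith _xor_

∈Δ⁺ : ∀ i (x y : Vertex n) → lookup x i ≢ lookup y i → i ∈ Δ x y
∈Δ⁺ zero    (true ∷ x)  (false ∷ y) _  = here
∈Δ⁺ zero    (false ∷ x) (true ∷ y)  _  = here
∈Δ⁺ zero    (true ∷ x)  (true ∷ y)  ne = ⊥-elim (ne refl)
∈Δ⁺ zero    (false ∷ x) (false ∷ y) ne = ⊥-elim (ne refl)
∈Δ⁺ (suc i) (a ∷ x)     (b ∷ y)     ne = there (∈Δ⁺ i x y ne)

∈Δ⁻ : ∀ i (x y : Vertex n) → i ∈ Δ x y → lookup x i ≢ lookup y i
∈Δ⁻ zero    (true ∷ x)  (false ∷ y) here      = λ ()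
∈Δ⁻ zero    (false ∷ x) (true ∷ y)  here      = λ ()
∈Δ⁻ (suc i) (a ∷ x)     (b ∷ y)     (there p) = ∈Δ⁻ i x y p

∉Δ⇒≡ : ∀ i (x y : Vertex n) → i ∉ Δ x y → lookup x i ≡ lookup y i
∉Δ⇒≡ i x y i∉Δ = decidable-stable (lookup x i ≟ᵇ lookup y i) (i∉Δ ∘ ∈Δ⁺ i x y)

Δ-sym : ∀ (x y : Vertex n) → Δ x y ⊆ Δ y x
Δ-sym x y {i} i∈Δ = ∈Δ⁺ i y x (∈Δ⁻ i x y i∈Δ ∘ sym)

Δ-triangle : ∀ (x y z : Vertex n) → i ∈ Δ x z → i ∈ Δ x y ⊎ i ∈ Δ y z
Δ-triangle {i = i} x y z i∈Δ with lookup x i ≟ᵇ lookup y i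
... | yes x≡y = inj₂ (∈Δ⁺ i y z (λ y≡z → ∈Δ⁻ i x z i∈Δ (trans x≡y y≡z)))
... | no  x≢y = inj₁ (∈Δ⁺ i x y x≢y)

≢⇒∈Δ : ∀ (x y : Vertex n) → x ≢ y → ∃[ i ] i ∈ Δ x y
≢⇒∈Δ []      []      x≢y = ⊥-elim (x≢y refl)
≢⇒∈Δ (a ∷ x) (b ∷ y) x≢y with a ≟ᵇ b
... | no  a≢b  = zero , ∈Δ⁺ zero (a ∷ x) (b ∷ y) a≢b
... | yes refl = let i , i∈Δ = ≢⇒∈Δ x y (x≢y ∘ cong (a ∷_)) in suc i , there i∈Δ

∈Δ-toggleˡ : ∀ (x y : Vertex n) → j ∈ Δ (toggle i x) y → j ≡ i ⊎ j ∈ Δ x y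
∈Δ-toggleˡ {j = j} {i = i} x y j∈Δ with j ≟ i
... | yes j≡i = inj₁ j≡i
... | no  j≢i = inj₂ (∈Δ⁺ j x y (∈Δ⁻ j (toggle i x) y j∈Δ ∘ trans (lookup-toggle′ j≢i x)))

∈Δ-toggleʳ : ∀ (x y : Vertex n) → j ∈ Δ x (toggle i y) → j ≡ i ⊎ j ∈ Δ x y
∈Δ-toggleʳ x y j∈Δ = map₂ (Δ-sym y x) (∈Δ-toggleˡ y x (Δ-sym x _ j∈Δ))

Δ-toggle-both : ∀ i (x y : Vertex n) → Δ (toggle i x) (toggle i y) ≡ Δ x y
Δ-toggle-both zero    (true ∷ x)  (true ∷ y)  = refl
Δ-toggle-both zero    (true ∷ x)  (false ∷ y) = refl
Δ-toggle-both zero    (false ∷ x) (true ∷ y)  = refl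
Δ-toggle-both zero    (false ∷ x) (false ∷ y) = refl
Δ-toggle-both (suc i) (a ∷ x)     (b ∷ y)     = cong ((a xor b) ∷_) (Δ-toggle-both i x y)

hamming≡∣Δ∣ : ∀ (x y : Vertex n) → hamming x y ≡ ∣ Δ x y ∣
hamming≡∣Δ∣ []      []      = refl
hamming≡∣Δ∣ (a ∷ x) (b ∷ y) with a xor b
... | true  = cong suc (hamming≡∣Δ∣ x y)
... | false = hamming≡∣Δ∣ x y

hamming-toggle-both : ∀ i (x y : Vertex n) → hamming (toggle i x) (toggle i y) ≡ hamming x y
hamming-toggle-both i x y = begin
  hamming (toggle i x) (toggle i y) ≡⟨ hamming≡∣Δ∣ (toggle i x) (toggle i y) ⟩
  ∣ Δ (toggle i x) (toggle i y) ∣   ≡⟨ cong ∣_∣ (Δ-toggle-both i x y) ⟩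
  ∣ Δ x y ∣                         ≡⟨ sym (hamming≡∣Δ∣ x y) ⟩
  hamming x y                       ∎
  where open ≡-Reasoning

2≤hamming : i ∈ Δ x y → j ∈ Δ x y → i ≢ j → 2 ≤ hamming x y
2≤hamming {x = x} {y = y} i∈Δ j∈Δ i≢j = subst (2 ≤_) (sym (hamming≡∣Δ∣ x y)) (2≤∣p∣ i∈Δ j∈Δ i≢j)

toggle-agrees : ∀ (x y : Vertex n) → i ∈ Δ x y → lookup (toggle i x) i ≡ lookup y i
toggle-agrees {i = i} x y i∈Δ = trans (lookup-toggle i x) (sym (¬-not (∈Δ⁻ i y x (Δ-sym x y i∈Δ))))

toggle-∉Δ : ∀ (x y : Vertex n) → i ∈ Δ x y → i ∉ Δ (toggle i x) y
toggle-∉Δ {i = i} x y i∈Δ i∈Δ′ = ∈Δ⁻ i (toggle i x) y i∈Δ′ (toggle-agrees x y i∈Δ)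

toggle-differs : ∀ i (x : Vertex n) → lookup x i ≢ lookup (toggle i x) i
toggle-differs i x eq = not-¬ refl (trans eq (lookup-toggle i x))

toggles-differ : ∀ (x : Vertex n) → i ≢ j → lookup (toggle i x) i ≢ lookup (toggle j x) i
toggles-differ {i = i} x i≢j eq = toggle-differs i x (sym (trans eq (lookup-toggle′ i≢j x)))

toggles-far : ∀ (x : Vertex n) → i ≢ j → 2 ≤ hamming (toggle i x) (toggle j x)
toggles-far {i = i} {j = j} x i≢j = 2≤hamming (∈Δ⁺ i (toggle i x) (toggle j x) (toggles-differ x i≢j))
                                              (∈Δ⁺ j (toggle i x) (toggle j x) (toggles-differ x (i≢j ∘ sym) ∘ sym))
                                              i≢j

common-direction : ∀ (y v : Vertex n) c → y ≢ v → toggle c y ≢ v → ∃[ i ] (i ∈ Δ y v × i ∈ Δ (toggle c y) v)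
common-direction y v c y≢v y′≢v with ≢⇒∈Δ y v y≢v
... | i , i∈Δ with i ≟ c
...   | no  i≢c  = i , i∈Δ , ∈Δ⁺ i (toggle c y) v (∈Δ⁻ i y v i∈Δ ∘ trans (sym (lookup-toggle′ i≢c y)))
...   | yes refl =
  let i′ , i′∈Δ = ≢⇒∈Δ (toggle c y) v y′≢v
  in i′ , [ (λ i′≡i → ⊥-elim (toggle-∉Δ y v i∈Δ (subst (_∈ _) i′≡i i′∈Δ))) , id ]′ (∈Δ-toggleˡ y v i′∈Δ) , i′∈Δ

-- Subcubes

-- ⟨ b , M ⟩ consists of the vertices that agree with b outside the free coordinates M.
data Subcube (n : ℕ) : Set where
  ⟨_,_⟩ : Vertex n → Subset n → Subcube n

_∈ᶜ_ : Vertex n → Subcube n → Set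
x ∈ᶜ ⟨ b , M ⟩ = Δ b x ⊆ M

_∈ᶜ?_ : ∀ (x : Vertex n) C → Dec (x ∈ᶜ C)
x ∈ᶜ? ⟨ b , M ⟩ = Δ b x ⊆? M

_⊆ᶜ_ : Subcube n → Subcube n → Set
C ⊆ᶜ D = ∀ {x} → x ∈ᶜ C → x ∈ᶜ D

span : Vertex n → Vertex n → Subcube n
span u v = ⟨ u , Δ u v ⟩

base∈ᶜ : ∀ (b : Vertex n) M → b ∈ᶜ ⟨ b , M ⟩
base∈ᶜ b M {i} i∈Δ = ⊥-elim (∈Δ⁻ i b b i∈Δ refl)

toggle∈ᶜ : ∀ {b : Vertex n} {M} → i ∈ M → x ∈ᶜ ⟨ b , M ⟩ → toggle i x ∈ᶜ ⟨ b , M ⟩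
toggle∈ᶜ {x = x} {b = b} i∈M x∈C j∈Δ = [ (λ { refl → i∈M }) , x∈C ] (∈Δ-toggleʳ b x j∈Δ)

∈ᶜ-fixed : ∀ {b : Vertex n} {M} → x ∈ᶜ ⟨ b , M ⟩ → i ∉ M → lookup b i ≡ lookup x i
∈ᶜ-fixed {x = x} {i = i} {b = b} x∈C i∉M = ∉Δ⇒≡ i b x (i∉M ∘ x∈C)

⟨,⟩-⊆ᶜ : ∀ {b w : Vertex n} {M M′} → w ∈ᶜ ⟨ b , M ⟩ → M′ ⊆ M → ⟨ w , M′ ⟩ ⊆ᶜ ⟨ b , M ⟩
⟨,⟩-⊆ᶜ {b = b} {w} w∈C M′⊆M {x} x∈C′ i∈Δ = [ w∈C , M′⊆M ∘ x∈C′ ] (Δ-triangle b w x i∈Δ)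

span-Δ⊆ : ∀ {u v y : Vertex n} → y ∈ᶜ span u v → Δ y v ⊆ Δ u v
span-Δ⊆ {u = u} {v} {y} y∈span j∈Δ = [ y∈span ∘ Δ-sym y u , id ] (Δ-triangle y u v j∈Δ)

span-toggle⊆ : ∀ {u v : Vertex n} → i ∈ Δ u v → span (toggle i u) v ⊆ᶜ span u v
span-toggle⊆ {u = u} {v} i∈Δ =
  ⟨,⟩-⊆ᶜ (toggle∈ᶜ i∈Δ (base∈ᶜ u (Δ u v))) (λ j∈Δ → [ (λ { refl → i∈Δ }) , id ] (∈Δ-toggleˡ u v j∈Δ))

∈span-toggle⇒agree : ∀ {u v : Vertex n} → i ∈ Δ u v → y ∈ᶜ span (toggle i u) v → lookup y i ≡ lookup v i
∈span-toggle⇒agree {u = u} {v} i∈Δ y∈span =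
  trans (sym (∈ᶜ-fixed y∈span (toggle-∉Δ u v i∈Δ))) (toggle-agrees u v i∈Δ)

span-toggle⊆⟨⟩ : ∀ {u v : Vertex n} {M} → i ∈ M → Δ u v ⊆ M → span (toggle i u) v ⊆ᶜ ⟨ u , M ⟩
span-toggle⊆⟨⟩ {u = u} {v} {M} i∈M Δ⊆M =
  ⟨,⟩-⊆ᶜ (toggle∈ᶜ i∈M (base∈ᶜ u M)) (λ j∈Δ → [ (λ { refl → i∈M }) , Δ⊆M ]′ (∈Δ-toggleˡ u v j∈Δ))

translate : Fin n → Vertex n → Vertex n → Subcube n
translate k u v = span (toggle k u) (toggle k v)

translate⊆ : ∀ {u v : Vertex n} {M} → k ∈ M → Δ u v ⊆ M → translate k u v ⊆ᶜ ⟨ u , M ⟩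
translate⊆ {k = k} {u} {v} {M} k∈M Δ⊆M =
  ⟨,⟩-⊆ᶜ (toggle∈ᶜ k∈M (base∈ᶜ u M)) (Δ⊆M ∘ subst (_ ∈_) (Δ-toggle-both k u v))

translate-fixed : ∀ {u v : Vertex n} → j ∉ Δ u v → x ∈ᶜ translate k u v → lookup x j ≡ lookup (toggle k u) j
translate-fixed {k = k} {u} {v} j∉Δ x∈T = sym (∈ᶜ-fixed x∈T (j∉Δ ∘ subst (_ ∈_) (Δ-toggle-both k u v)))

translates-far : ∀ {u v : Vertex n} {k k′} → k ∉ Δ u v → k′ ∉ Δ u v → k ≢ k′ →
                 x ∈ᶜ translate k u v → y ∈ᶜ translate k′ u v → 2 ≤ hamming x y
translates-far {x = x} {y} {u = u} {k = k} {k′} k∉Δ k′∉Δ k≢k′ x∈T y∈T′ =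
  2≤hamming (∈Δ⁺ k x y (λ eq → toggles-differ u k≢k′
                                  (trans (sym (translate-fixed k∉Δ x∈T)) (trans eq (translate-fixed k∉Δ y∈T′)))))
            (∈Δ⁺ k′ x y (λ eq → toggles-differ u (k≢k′ ∘ sym)
                                   (trans (sym (translate-fixed k′∉Δ y∈T′)) (trans (sym eq) (translate-fixed k′∉Δ x∈T)))))
            k≢k′

_∈S?_ : ∀ (x : Vertex n) S → Dec (x ∈S S)
x ∈S? vtx a      = ≡-dec _≟ᵇ_ x a
x ∈S? edge a b _ = ≡-dec _≟ᵇ_ x a ⊎-dec ≡-dec _≟ᵇ_ x b

∈S⇒hamming≤1 : ∀ (S : Q1Sub n) → x ∈S S → y ∈S S → hamming x y ≤ 1
∈S⇒hamming≤1 (vtx a)        refl        refl        = ≤-trans (≤-reflexive (hamming-refl a)) z≤n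
∈S⇒hamming≤1 (edge a b _)   (inj₁ refl) (inj₁ refl) = ≤-trans (≤-reflexive (hamming-refl a)) z≤n
∈S⇒hamming≤1 (edge a b _)   (inj₂ refl) (inj₂ refl) = ≤-trans (≤-reflexive (hamming-refl b)) z≤n
∈S⇒hamming≤1 (edge a b adj) (inj₁ refl) (inj₂ refl) = ≤-reflexive adj
∈S⇒hamming≤1 (edge a b adj) (inj₂ refl) (inj₁ refl) = ≤-reflexive (adj-sym a b adj)

-- The direction argument serves only single vertices, for which any direction will do.
∈S⇒≡⊎toggle : ∀ (S : Q1Sub n) → Fin n → x ∈S S → ∃[ c ] (∀ {y} → y ∈S S → y ≡ x ⊎ y ≡ toggle c x)
∈S⇒≡⊎toggle (vtx a)        c refl        = c , λ { refl → inj₁ refl }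
∈S⇒≡⊎toggle (edge a b adj) _ (inj₁ refl) =
  let c , b≡ = adj⇒toggle a b adj in c , λ { (inj₁ refl) → inj₁ refl ; (inj₂ refl) → inj₂ b≡ }
∈S⇒≡⊎toggle (edge a b adj) _ (inj₂ refl) =
  let c , a≡ = adj⇒toggle b a (adj-sym a b adj) in c , λ { (inj₁ refl) → inj₂ a≡ ; (inj₂ refl) → inj₁ refl }

module _ {ℓ : Level} where

  Meets : Pred (Vertex n) ℓ → Pred (Q1Sub n) ℓ
  Meets A S = ∃[ x ] (x ∈S S × A x)

  meets? : {A : Pred (Vertex n) ℓ} → Decidable A → Decidable (Meets A)
  meets? A? (vtx a)      = map′ (λ a∈A → a , refl , a∈A) (λ { (_ , refl , x∈A) → x∈A }) (A? a)
  meets? A? (edge a b _) = map′ [ (λ a∈A → a , inj₁ refl , a∈A) , (λ b∈A → b , inj₂ refl , b∈A) ]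
                                (λ { (_ , inj₁ refl , x∈A) → inj₁ x∈A ; (_ , inj₂ refl , x∈A) → inj₂ x∈A })
                                (A? a ⊎-dec A? b)

  Meets-mono : {A B : Pred (Vertex n) ℓ} → (∀ {x} → A x → B x) → ∀ {S} → Meets A S → Meets B S
  Meets-mono A⇒B (x , x∈S , x∈A) = x , x∈S , A⇒B x∈A

  far⇒¬Meets-both : {A B : Pred (Vertex n) ℓ} → (∀ {x y} → A x → B y → 2 ≤ hamming x y) →
                    ∀ {S} → Meets A S → Meets B S → ⊥
  far⇒¬Meets-both far {S} (x , x∈S , x∈A) (y , y∈S , y∈B) = ≤⇒≯ (∈S⇒hamming≤1 S x∈S y∈S) (far x∈A y∈B)

∈S-keeps-one-of : ∀ {ℓ} (S : Q1Sub n) {P : Pred (Fin n) ℓ} {i₁ i₂} → x ∈S S → P i₁ → P i₂ → i₁ ≢ i₂ →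
                  ∃[ i ] (P i × ∀ {y} → y ∈S S → lookup y i ≡ lookup x i)
∈S-keeps-one-of {x = x} S {P = P} {i₁} {i₂} x∈S p₁ p₂ i₁≢i₂ with ∈S⇒≡⊎toggle S i₁ x∈S
... | c , star = choose (i₁ ≟ c)
  where
  keeps : ∀ {i y} → i ≢ c → y ∈S S → lookup y i ≡ lookup x i
  keeps i≢c y∈S with star y∈S
  ... | inj₁ refl = refl
  ... | inj₂ refl = lookup-toggle′ i≢c x
  choose : Dec (i₁ ≡ c) → ∃[ i ] (P i × ∀ {y} → y ∈S S → lookup y i ≡ lookup x i)
  choose (no  i₁≢c) = i₁ , p₁ , keeps i₁≢c
  choose (yes refl) = i₂ , p₂ , keeps (i₁≢i₂ ∘ sym)

escaping-direction : ∀ {u v : Vertex n} S → (∀ {y} → y ∈S S → y ≢ v) → Meets (_∈ᶜ span u v) S →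
                     ∃[ i ] (i ∈ Δ u v × ∀ {y} → y ∈S S → i ∈ Δ y v)
escaping-direction {v = v} (vtx a) ≢v (_ , refl , a∈span) =
  let i , i∈Δ = ≢⇒∈Δ a v (≢v refl) in i , span-Δ⊆ a∈span i∈Δ , λ { refl → i∈Δ }
escaping-direction {v = v} (edge a b adj) ≢v (_ , inj₁ refl , a∈span) =
  let c , b≡ = adj⇒toggle a b adj
      i , i∈Δa , i∈Δb = common-direction a v c (≢v (inj₁ refl)) (≢v (inj₂ (sym b≡)))
  in i , span-Δ⊆ a∈span i∈Δa , λ { (inj₁ refl) → i∈Δa ; (inj₂ refl) → subst (λ w → i ∈ Δ w v) (sym b≡) i∈Δb }
escaping-direction {v = v} (edge a b adj) ≢v (_ , inj₂ refl , b∈span) =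
  let c , a≡ = adj⇒toggle b a (adj-sym a b adj)
      i , i∈Δb , i∈Δa = common-direction b v c (≢v (inj₂ refl)) (≢v (inj₁ (sym a≡)))
  in i , span-Δ⊆ b∈span i∈Δb , λ { (inj₁ refl) → subst (λ w → i ∈ Δ w v) (sym a≡) i∈Δa ; (inj₂ refl) → i∈Δb }

-- Geodesics

-- While 2 + c ≤ d, each step of geodesic can leave a member behind; for d = 2 a single member cannot
-- contain both middle vertices.
Sparse : ℕ → ℕ → Set
Sparse c d = d ≤ 1 ⊎ 2 + c ≤ d ⊎ (c ≤ 1 × d ≤ 2)

sparse? : ∀ c d → Dec (Sparse c d)
sparse? c d = d ≤? 1 ⊎-dec 2 + c ≤? d ⊎-dec (c ≤? 1 ×-dec d ≤? 2)

Sparse-antimono : ∀ {c′ c d} → c′ ≤ c → Sparse c d → Sparse c′ d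
Sparse-antimono c′≤c (inj₁ d≤1)                = inj₁ d≤1
Sparse-antimono c′≤c (inj₂ (inj₁ 2+c≤d))       = inj₂ (inj₁ (≤-trans (+-monoʳ-≤ 2 c′≤c) 2+c≤d))
Sparse-antimono c′≤c (inj₂ (inj₂ (c≤1 , d≤2))) = inj₂ (inj₂ (≤-trans c′≤c c≤1 , d≤2))

Sparse-0 : ∀ d → Sparse 0 d
Sparse-0 zero          = inj₁ z≤n
Sparse-0 (suc zero)    = inj₁ ≤-refl
Sparse-0 (suc (suc d)) = inj₂ (inj₁ (s≤s (s≤s z≤n)))

¬Sparse⇒ : ∀ {c d} → ¬ Sparse c d → 2 ≤ c × d ≤ suc c
¬Sparse⇒ {c} {d} ¬sparse with d ≤? suc c
... | no  d≰1+c = ⊥-elim (¬sparse (inj₂ (inj₁ (≰⇒> d≰1+c))))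
... | yes d≤1+c with 2 ≤? c
...   | yes 2≤c = 2≤c , d≤1+c
...   | no  2≰c =
  let c≤1 = ≤-pred (≰⇒> 2≰c) in ⊥-elim (¬sparse (inj₂ (inj₂ (c≤1 , ≤-trans d≤1+c (s≤s c≤1)))))

crowded : ∀ {d} x xs → d ≤ suc x → All (2 ≤_) xs → d + 2 * length xs ≤ suc x + sum xs
crowded {d} x []       d≤1+x []           = +-monoˡ-≤ 0 d≤1+x
crowded {d} x (y ∷ ys) d≤1+x (2≤y ∷ 2≤ys) = begin
  d + 2 * suc (length ys)     ≡⟨ rearrange d (length ys) ⟩
  2 + (d + 2 * length ys)     ≤⟨ +-mono-≤ 2≤y (crowded x ys d≤1+x 2≤ys) ⟩
  y + (suc x + sum ys)        ≡⟨ x∙yz≈y∙xz y (suc x) (sum ys) ⟩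
  suc x + (y + sum ys)        ∎
  where
  open ≤-Reasoning
  rearrange : ∀ d l → d + 2 * suc l ≡ 2 + (d + 2 * l)
  rearrange = solve-∀

module Faults {n : ℕ} (F : List (Q1Sub n)) where

  Alive : Vertex n → Set
  Alive x = ¬ Removed F x

  removed? : ∀ x → Dec (Removed F x)
  removed? x = any? (x ∈S?_) F

  alive? : ∀ x → Dec (Alive x)
  alive? x = ¬? (removed? x)

  #meeting : Subcube n → ℕ
  #meeting C = count (meets? (_∈ᶜ? C)) F

  #meeting-mono : ∀ {C D} → C ⊆ᶜ D → #meeting C ≤ #meeting D
  #meeting-mono C⊆D = count-mono _ _ (Meets-mono C⊆D) F

  #meeting-< : ∀ {C D S} → C ⊆ᶜ D → S ∈ₗ F → Meets (_∈ᶜ D) S → ¬ Meets (_∈ᶜ C) S → #meeting C < #meeting D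
  #meeting-< C⊆D S∈F meets misses = count-mono-< _ _ (Meets-mono C⊆D) (lose S∈F (meets , misses))

  Walk≤ : Vertex n → Vertex n → ℕ → Set
  Walk≤ u v ℓ = ∃[ k ] (k ≤ ℓ × Walk F u v k)

  snoc : ∀ {u v w k} → Walk F u v k → Adj v w → Alive w → Walk F u w (suc k)
  snoc (here au)           adj aw = step au adj (here aw)
  snoc (step au adj′ walk) adj aw = step au adj′ (snoc walk adj aw)

  removed-directions≤#meeting : ∀ (u v : Vertex n) →
    count (λ i → removed? (toggle i u)) (elements (Δ u v)) ≤ #meeting (span u v)
  removed-directions≤#meeting u v = begin
    count (λ i → removed? (toggle i u)) L  ≤⟨ count≤sum _ #containing (λ {i} → Any⇒0<count (toggle i u ∈S?_)) L ⟩
    sum (map #containing L)                ≤⟨ sum-count≤count (λ i → toggle i u ∈S?_) _ L apart inside F ⟩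
    #meeting (span u v)                    ∎
    where
    open ≤-Reasoning
    L = elements (Δ u v)
    #containing : Fin n → ℕ
    #containing i = count (toggle i u ∈S?_) F
    apart : AllPairs (λ i j → ∀ {S} → toggle i u ∈S S → toggle j u ∈S S → ⊥) L
    apart = AllPairs.map (λ i≢j {S} x∈S y∈S → ≤⇒≯ (∈S⇒hamming≤1 S x∈S y∈S) (toggles-far u i≢j))
                         (elements-unique (Δ u v))
    inside : All (λ i → ∀ {S} → toggle i u ∈S S → Meets (_∈ᶜ span u v) S) L
    inside = All.map toggle-meets (elements⊆ (Δ u v))
      where
      toggle-meets : ∀ {i} → i ∈ Δ u v → ∀ {S} → toggle i u ∈S S → Meets (_∈ᶜ span u v) S
      toggle-meets {i} i∈Δ x∈S = toggle i u , x∈S , toggle∈ᶜ i∈Δ (base∈ᶜ u (Δ u v))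

  hamming≤#meeting+alive : ∀ (u v : Vertex n) →
    hamming u v ≤ #meeting (span u v) + count (λ i → alive? (toggle i u)) (elements (Δ u v))
  hamming≤#meeting+alive u v = begin
    hamming u v                         ≡⟨ hamming≡∣Δ∣ u v ⟩
    ∣ Δ u v ∣                           ≡⟨ sym (length-elements (Δ u v)) ⟩
    length L                            ≡⟨ sym (count+count∁≡length removed-at L) ⟩
    count removed-at L + #alive         ≤⟨ +-monoˡ-≤ #alive (removed-directions≤#meeting u v) ⟩
    #meeting (span u v) + #alive        ∎
    where
    open ≤-Reasoning
    L = elements (Δ u v)
    removed-at = λ i → removed? (toggle i u)
    #alive = count (λ i → alive? (toggle i u)) L

  alive-neighbour : ∀ {u v : Vertex n} → #meeting (span u v) < hamming u v →
                    ∃[ i ] (i ∈ Δ u v × Alive (toggle i u))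
  alive-neighbour {u} {v} c<d =
    let i , i∈L , alive = find (0<count⇒Any (λ i → alive? (toggle i u)) (elements (Δ u v)) 0<#alive)
    in i , All.lookup (elements⊆ (Δ u v)) i∈L , alive
    where
    c = #meeting (span u v)
    #alive = count (λ i → alive? (toggle i u)) (elements (Δ u v))
    0<#alive : 0 < #alive
    0<#alive = +-cancelˡ-< c 0 #alive (subst (_< c + #alive) (sym (+-identityʳ c))
                                             (<-≤-trans c<d (hamming≤#meeting+alive u v)))

  two-alive-neighbours : ∀ {u v : Vertex n} → 2 + #meeting (span u v) ≤ hamming u v →
    ∃[ i ] ∃[ j ] (i ≢ j × (i ∈ Δ u v × Alive (toggle i u)) × (j ∈ Δ u v × Alive (toggle j u)))
  two-alive-neighbours {u} {v} 2+c≤d =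
    let i , j , i≢j , (i∈L , alive-i) , (j∈L , alive-j) =
          2≤count⇒distinct (λ i → alive? (toggle i u)) (elements-unique (Δ u v)) 2≤#alive
    in i , j , i≢j , (All.lookup (elements⊆ (Δ u v)) i∈L , alive-i)
                   , (All.lookup (elements⊆ (Δ u v)) j∈L , alive-j)
    where
    c = #meeting (span u v)
    #alive = count (λ i → alive? (toggle i u)) (elements (Δ u v))
    2≤#alive : 2 ≤ #alive
    2≤#alive = +-cancelˡ-≤ c 2 #alive (subst (_≤ c + #alive) (+-comm 2 c)
                                            (≤-trans 2+c≤d (hamming≤#meeting+alive u v)))

  Progress : Vertex n → Vertex n → Set
  Progress u v =
    ∃[ i ] (i ∈ Δ u v × Alive (toggle i u) × #meeting (span (toggle i u) v) < #meeting (span u v))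

  #meeting-facet-< : ∀ {u v : Vertex n} {S i} → S ∈ₗ F → Meets (_∈ᶜ span u v) S → i ∈ Δ u v →
                     (∀ {y} → y ∈S S → lookup y i ≢ lookup v i) →
                     #meeting (span (toggle i u) v) < #meeting (span u v)
  #meeting-facet-< S∈F meets i∈Δ differs =
    #meeting-< (span-toggle⊆ i∈Δ) S∈F meets (λ (y , y∈S , y∈facet) → differs y∈S (∈span-toggle⇒agree i∈Δ y∈facet))

  -- The member through the removed neighbour toggles at most one coordinate of it, so it misses the facet
  -- towards v along one of two surviving directions.
  progress-past-removed : ∀ {u v : Vertex n} {j} → j ∈ Δ u v → Removed F (toggle j u) →
                          2 + #meeting (span u v) ≤ hamming u v → Progress u v
  progress-past-removed {u} {v} {j} j∈Δ removed dense =
    let S , S∈F , z∈S = find removed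
        i₁ , i₂ , i₁≢i₂ , good₁ , good₂ = two-alive-neighbours dense
        i , (i∈Δ , alive) , keeps =
          ∈S-keeps-one-of S {P = λ i → i ∈ Δ u v × Alive (toggle i u)} z∈S good₁ good₂ i₁≢i₂
        i≢j : i ≢ j
        i≢j i≡j = alive (subst (λ k → Removed F (toggle k u)) (sym i≡j) removed)
        agrees : ∀ {y} → y ∈S S → lookup y i ≡ lookup u i
        agrees y∈S = trans (keeps y∈S) (lookup-toggle′ i≢j u)
    in i , i∈Δ , alive ,
       #meeting-facet-< S∈F (toggle j u , z∈S , toggle∈ᶜ j∈Δ (base∈ᶜ u (Δ u v))) i∈Δ
                        (λ y∈S → ∈Δ⁻ i u v i∈Δ ∘ trans (sym (agrees y∈S)))

  progress-past-meeting : ∀ {u v : Vertex n} → Alive v → (∀ {j} → j ∈ Δ u v → Alive (toggle j u)) →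
                          0 < #meeting (span u v) → Progress u v
  progress-past-meeting {u} {v} av all-alive 0<c =
    let S , S∈F , meets = find (0<count⇒Any _ F 0<c)
        i , i∈Δ , escapes = escaping-direction S (λ y∈S y≡v → av (subst (Removed F) y≡v (lose S∈F y∈S))) meets
    in i , i∈Δ , all-alive i∈Δ , #meeting-facet-< S∈F meets i∈Δ (λ y∈S → ∈Δ⁻ _ _ v (escapes y∈S))

  progress : ∀ {u v : Vertex n} → Alive v → 0 < #meeting (span u v) → 2 + #meeting (span u v) ≤ hamming u v →
             Progress u v
  progress {u} {v} av 0<c dense with anyᶠ? (λ j → j ∈? Δ u v ×-dec removed? (toggle j u))
  ... | yes (j , j∈Δ , removed) = progress-past-removed j∈Δ removed dense
  ... | no  none                = progress-past-meeting av (λ j∈Δ removed → none (_ , j∈Δ , removed)) 0<c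

  next-hop : ∀ d {u v : Vertex n} → Alive v → Sparse (#meeting (span u v)) (2 + d) → hamming u v ≡ 2 + d →
             ∃[ i ] (i ∈ Δ u v × Alive (toggle i u) × Sparse (#meeting (span (toggle i u) v)) (suc d))
  next-hop d av (inj₁ (s≤s ()))
  next-hop d {u} {v} av (inj₂ (inj₂ (c≤1 , s≤s (s≤s z≤n)))) d≡2 =
    let i , i∈Δ , alive = alive-neighbour (≤-trans (s≤s c≤1) (≤-reflexive (sym d≡2)))
    in i , i∈Δ , alive , inj₁ ≤-refl
  next-hop d {u} {v} av (inj₂ (inj₁ dense)) d≡2+d with 0 <? #meeting (span u v)
  ... | yes 0<c =
    let i , i∈Δ , alive , shrinks = progress av 0<c (≤-trans dense (≤-reflexive (sym d≡2+d)))
    in i , i∈Δ , alive , inj₂ (inj₁ (≤-trans (s≤s shrinks) (≤-pred dense)))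
  ... | no  c≮0 =
    let i , i∈Δ , alive = alive-neighbour (≤-trans (s≤s (≮⇒≥ c≮0)) (≤-trans (s≤s z≤n) (≤-reflexive (sym d≡2+d))))
    in i , i∈Δ , alive ,
       Sparse-antimono (≤-trans (#meeting-mono (span-toggle⊆ i∈Δ)) (≮⇒≥ c≮0)) (Sparse-0 (suc d))

  geodesic : ∀ d {u v : Vertex n} → Alive u → Alive v → Sparse (#meeting (span u v)) d → hamming u v ≡ d →
             Walk F u v d
  geodesic zero          {u} {v} au av _      d≡0   = subst (λ w → Walk F u w 0) (hamming≡0⇒≡ u v d≡0) (here au)
  geodesic (suc zero)            au av _      adj   = step au adj (here av)
  geodesic (suc (suc d)) {u} {v} au av sparse d≡2+d =
    let i , i∈Δ , alive , sparse′ = next-hop d av sparse d≡2+d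
        d′≡1+d = suc-injective (trans (hamming-toggle-differing i u v (∈Δ⁻ i u v i∈Δ)) d≡2+d)
    in step au (adj-toggle i u) (geodesic (suc d) alive av sparse′ d′≡1+d)

  -- Walks within a subcube

  #meeting-fix-< : ∀ {b x : Vertex n} {M k} → x ∈ᶜ ⟨ b , M ⟩ → lookup b k ≢ lookup x k →
                   Alive (toggle k x) → Removed F x → #meeting ⟨ b , M - k ⟩ < #meeting ⟨ b , M ⟩
  #meeting-fix-< {b} {x} {M} {k} x∈C b≢x alive removed with find removed
  ... | S , S∈F , x∈S with ∈S⇒≡⊎toggle S k x∈S
  ...   | c , star = #meeting-< (⟨,⟩-⊆ᶜ (base∈ᶜ b M) (p─q⊆p M ⁅ k ⁆)) S∈F (x , x∈S , x∈C) misses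
    where
    differs : ∀ {y} → y ∈S S → lookup b k ≢ lookup y k
    differs y∈S with star y∈S | c ≟ k
    ... | inj₁ refl | _        = b≢x
    ... | inj₂ refl | yes refl = ⊥-elim (alive (lose S∈F y∈S))
    ... | inj₂ refl | no  c≢k  = b≢x ∘ flip trans (lookup-toggle′ (c≢k ∘ sym) x)
    misses : ¬ Meets (_∈ᶜ ⟨ b , M - k ⟩) S
    misses (y , y∈S , y∈C′) = differs y∈S (∈ᶜ-fixed y∈C′ (x∉p-x M k))

  module _ (u v : Vertex n) (au : Alive u) (av : Alive v) where

    private
      d = hamming u v

    via-translate : ∀ {k} → k ∉ Δ u v → Alive (toggle k u) → Alive (toggle k v) →
                    Sparse (#meeting (translate k u v)) d → Walk F u v (2 + d)
    via-translate {k} k∉Δ alive-u′ alive-v′ sparse =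
      step au (adj-toggle k u)
           (snoc (geodesic d alive-u′ alive-v′ sparse (hamming-toggle-both k u v))
                 (subst (Adj (toggle k v)) (toggle-involutive k v) (adj-toggle k (toggle k v)))
                 av)

    via-neighbour : ∀ {k} → k ∉ Δ u v → Alive (toggle k u) → Sparse (#meeting (span (toggle k u) v)) (suc d) →
                    Walk F u v (2 + d)
    via-neighbour {k} k∉Δ alive-u′ sparse =
      step au (adj-toggle k u) (geodesic (suc d) alive-u′ av sparse (hamming-toggle-agreeing k u v (∉Δ⇒≡ k u v k∉Δ)))

    translates-sum≤ : ∀ {M} → Δ u v ⊆ M → ∀ ks → Unique ks → All (_∈ M ─ Δ u v) ks →
                      sum (map (λ k → #meeting (translate k u v)) ks) ≤ #meeting ⟨ u , M ⟩
    translates-sum≤ {M} Δ⊆M ks unique ks⊆K =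
      sum-count≤count (λ k → meets? (_∈ᶜ? translate k u v)) _ ks (apart unique ks⊆K) (All.map inside ks⊆K) F
      where
      inside : ∀ {k} → k ∈ M ─ Δ u v → ∀ {S} → Meets (_∈ᶜ translate k u v) S → Meets (_∈ᶜ ⟨ u , M ⟩) S
      inside k∈K = Meets-mono (translate⊆ (proj₁ (x∈p─q⁻ M (Δ u v) k∈K)) Δ⊆M)

      apart : ∀ {ks} → Unique ks → All (_∈ M ─ Δ u v) ks →
              AllPairs (λ k k′ → ∀ {S} → Meets (_∈ᶜ translate k u v) S → Meets (_∈ᶜ translate k′ u v) S → ⊥) ks
      apart         []              []           = []
      apart {k ∷ _} (k∉ks ∷ unique) (k∈K ∷ ks⊆K) = All.zipWith disjoint (k∉ks , ks⊆K) ∷ apart unique ks⊆K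
        where
        disjoint : ∀ {k′} → k ≢ k′ × k′ ∈ M ─ Δ u v →
                   ∀ {S} → Meets (_∈ᶜ translate k u v) S → Meets (_∈ᶜ translate k′ u v) S → ⊥
        disjoint (k≢k′ , k′∈K) = far⇒¬Meets-both
          (translates-far (proj₂ (x∈p─q⁻ M (Δ u v) k∈K)) (proj₂ (x∈p─q⁻ M (Δ u v) k′∈K)) k≢k′)

    crowded-translates : ∀ {M} → Δ u v ⊆ M → (∀ {k} → k ∈ M ─ Δ u v → ¬ Sparse (#meeting (translate k u v)) d) →
                         ∀ ks → Unique ks → All (_∈ M ─ Δ u v) ks →
                         2 + #meeting ⟨ u , M ⟩ ≤ length ks + d → 2 ≤ length ks → ⊥
    crowded-translates     Δ⊆M ¬sparse (k ∷ [])      _      _                      _        (s≤s ())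
    crowded-translates {M} Δ⊆M ¬sparse (k ∷ k′ ∷ ks) unique ks⊆K@(k∈K ∷ ks′⊆K) 2+c≤l+d _ =
      m+n≮n (length ks) (L + d) (begin-strict
        length ks + (L + d)        <⟨ n<1+n _ ⟩
        suc (length ks + (L + d))  ≡⟨ rearrange d (length ks) ⟩
        d + 2 * L                  ≡⟨ cong (λ l → d + 2 * l) (sym (length-map c (k′ ∷ ks))) ⟩
        d + 2 * length xs          ≤⟨ crowded (c k) xs (proj₂ (¬Sparse⇒ (¬sparse k∈K))) 2≤xs ⟩
        suc (c k + sum xs)         ≤⟨ s≤s (translates-sum≤ Δ⊆M (k ∷ k′ ∷ ks) unique ks⊆K) ⟩
        suc (#meeting ⟨ u , M ⟩)   ≤⟨ ≤-pred 2+c≤l+d ⟩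
        L + d                      ∎)
      where
      open ≤-Reasoning
      c : Fin n → ℕ
      c k = #meeting (translate k u v)
      xs = map c (k′ ∷ ks)
      L = suc (length ks)
      2≤xs : All (2 ≤_) xs
      2≤xs = All.map⁺ (All.map (proj₁ ∘ ¬Sparse⇒ ∘ ¬sparse) ks′⊆K)
      rearrange : ∀ d l → suc (l + (suc l + d)) ≡ d + 2 * suc l
      rearrange = solve-∀

    -- When d + 1 = m, a single step along K already leads into a span met by at most m − 2 members.
    escape : ∀ {m M} → ∣ M ∣ ≡ m → Δ u v ⊆ M → 2 + #meeting ⟨ u , M ⟩ ≤ m → ¬ Sparse (#meeting (span u v)) d →
             (∀ {k} → k ∈ M ─ Δ u v → Alive (toggle k u) × Alive (toggle k v)) → Walk≤ u v (suc m)
    escape {m} {M} ∣M∣≡m Δ⊆M dense ¬sparse intact = by-dimension (m ≤? suc d)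
      where
      K = M ─ Δ u v
      1+d≤m : suc d ≤ m
      1+d≤m = ≤-trans (s≤s (≤-trans (proj₂ (¬Sparse⇒ ¬sparse)) (s≤s (#meeting-mono (⟨,⟩-⊆ᶜ (base∈ᶜ u M) Δ⊆M))))) dense
      m≤∣K∣+d : m ≤ ∣ K ∣ + d
      m≤∣K∣+d = begin
        m                      ≡⟨ sym ∣M∣≡m ⟩
        ∣ M ∣                  ≤⟨ ∣p∣≤∣p─q∣+∣q∣ M (Δ u v) ⟩
        ∣ K ∣ + ∣ Δ u v ∣      ≡⟨ cong (∣ K ∣ +_) (sym (hamming≡∣Δ∣ u v)) ⟩
        ∣ K ∣ + d              ∎
        where open ≤-Reasoning
      by-translate : Dec (∃[ k ] (k ∈ K × Sparse (#meeting (translate k u v)) d)) → 2 + d ≤ m → Walk≤ u v (suc m)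
      by-translate (yes (k , k∈K , sparse)) 2+d≤m =
        2 + d , m≤n⇒m≤1+n 2+d≤m ,
        via-translate (proj₂ (x∈p─q⁻ M (Δ u v) k∈K)) (proj₁ (intact k∈K)) (proj₂ (intact k∈K)) sparse
      by-translate (no none) 2+d≤m = ⊥-elim
        (crowded-translates Δ⊆M (λ k∈K sparse → none (_ , k∈K , sparse))
          (elements K) (elements-unique K) (elements⊆ K)
          (subst (λ l → 2 + #meeting ⟨ u , M ⟩ ≤ l + d) (sym (length-elements K)) (≤-trans dense m≤∣K∣+d))
          (subst (2 ≤_) (sym (length-elements K)) (+-cancelʳ-≤ d 2 ∣ K ∣ (≤-trans 2+d≤m m≤∣K∣+d))))
      by-dimension : Dec (m ≤ suc d) → Walk≤ u v (suc m)
      by-dimension (no  m≰1+d) =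
        by-translate (anyᶠ? (λ k → k ∈? K ×-dec sparse? (#meeting (translate k u v)) d)) (≰⇒> m≰1+d)
      by-dimension (yes m≤1+d) =
        let k , k∈K = 0<∣p∣⇒nonempty K (+-cancelʳ-≤ d 1 ∣ K ∣ (≤-trans 1+d≤m m≤∣K∣+d))
            k∈M , k∉Δ = x∈p─q⁻ M (Δ u v) k∈K
        in 2 + d , s≤s 1+d≤m ,
           via-neighbour k∉Δ (proj₁ (intact k∈K))
             (inj₂ (inj₁ (≤-trans (+-monoʳ-≤ 2 (#meeting-mono (span-toggle⊆⟨⟩ k∈M Δ⊆M))) (≤-trans dense m≤1+d))))

    walk-within : ∀ m {M} → ∣ M ∣ ≡ m → Δ u v ⊆ M → 2 + #meeting ⟨ u , M ⟩ ≤ m → Walk≤ u v (suc m)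
    walk-within zero    _ _ ()
    walk-within (suc m) {M} ∣M∣≡1+m Δ⊆M dense = by-sparsity (sparse? (#meeting (span u v)) d)
      where
      K = M ─ Δ u v
      shrink : ∀ {k x} → k ∈ K → x ∈ᶜ ⟨ u , M ⟩ → lookup u k ≢ lookup x k → Alive (toggle k x) → Removed F x →
               Walk≤ u v (suc (suc m))
      shrink {k} k∈K x∈C u≢x alive removed =
        let ℓ , ℓ≤1+m , walk = walk-within m ∣M-k∣≡m Δ⊆M-k dense′ in ℓ , m≤n⇒m≤1+n ℓ≤1+m , walk
        where
        ∣M-k∣≡m : ∣ M - k ∣ ≡ m
        ∣M-k∣≡m = suc-injective (trans (x∈p⇒1+∣p-x∣≡∣p∣ (proj₁ (x∈p─q⁻ M (Δ u v) k∈K))) ∣M∣≡1+m)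
        Δ⊆M-k : Δ u v ⊆ M - k
        Δ⊆M-k j∈Δ = x∈p∧x≢y⇒x∈p-y (Δ⊆M j∈Δ) (λ { refl → proj₂ (x∈p─q⁻ M (Δ u v) k∈K) j∈Δ })
        dense′ : 2 + #meeting ⟨ u , M - k ⟩ ≤ m
        dense′ = ≤-pred (≤-trans (+-monoʳ-≤ 2 (#meeting-fix-< x∈C u≢x alive removed)) dense)
      by-neighbours : Dec (∃[ k ] (k ∈ K × (Removed F (toggle k u) ⊎ Removed F (toggle k v)))) →
                      ¬ Sparse (#meeting (span u v)) d → Walk≤ u v (suc (suc m))
      by-neighbours (yes (k , k∈K , inj₁ removed)) _ =
        shrink k∈K (toggle∈ᶜ (proj₁ (x∈p─q⁻ M (Δ u v) k∈K)) (base∈ᶜ u M)) (toggle-differs k u)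
               (subst Alive (sym (toggle-involutive k u)) au) removed
      by-neighbours (yes (k , k∈K , inj₂ removed)) _ =
        shrink k∈K (toggle∈ᶜ (proj₁ (x∈p─q⁻ M (Δ u v) k∈K)) Δ⊆M)
               (toggle-differs k v ∘ trans (sym (∉Δ⇒≡ k u v (proj₂ (x∈p─q⁻ M (Δ u v) k∈K)))))
               (subst Alive (sym (toggle-involutive k v)) av) removed
      by-neighbours (no intact) ¬sparse =
        escape ∣M∣≡1+m Δ⊆M dense ¬sparse
               (λ k∈K → (λ r → intact (_ , k∈K , inj₁ r)) , (λ r → intact (_ , k∈K , inj₂ r)))
      by-sparsity : Dec (Sparse (#meeting (span u v)) d) → Walk≤ u v (suc (suc m))
      by-sparsity (yes sparse) =
        d , m≤n⇒m≤1+n (≤-trans (≤-reflexive (hamming≡∣Δ∣ u v)) (≤-trans (p⊆q⇒∣p∣≤∣q∣ Δ⊆M) (≤-reflexive ∣M∣≡1+m))) ,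
        geodesic d au av sparse refl
      by-sparsity (no ¬sparse) =
        by-neighbours (anyᶠ? (λ k → k ∈? K ×-dec (removed? (toggle k u) ⊎-dec removed? (toggle k v)))) ¬sparse

  diameter≤1+n : 2 + length F ≤ n → ∀ {u v} → Alive u → Alive v → Walk≤ u v (suc n)
  diameter≤1+n 2+|F|≤n {u} {v} au av =
    walk-within u v au av n (∣⊤∣≡n n) ⊆⊤ (≤-trans (+-monoʳ-≤ 2 (count≤length _ F)) 2+|F|≤n)

-- An upper bound on κ

κ≤length : ∀ {n κ} → IsKappaS n κ → ∀ F → PairwiseDisjoint F → Disconnects F → κ ≤ length F
κ≤length (_ , minimal) F disjoint disconnects = ≮⇒≥ (λ |F|<κ → minimal F disjoint |F|<κ disconnects)

walk-source-alive : ∀ {F : List (Q1Sub n)} {k} → Walk F x y k → ¬ Removed F x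
walk-source-alive (here ax)     = ax
walk-source-alive (step ax _ _) = ax

-- The spokes cut the edge between false ∷ zeros and true ∷ zeros off from the rest of the cube.
module Spokes (p : ℕ) where

  zeros : Vertex p
  zeros = replicate p false

  unit : Fin p → Vertex p
  unit j = toggle j zeros

  spoke : Fin p → Q1Sub (suc p)
  spoke j = edge (false ∷ unit j) (true ∷ unit j) (cong suc (hamming-refl (unit j)))

  spokes : List (Q1Sub (suc p))
  spokes = tabulate spoke

  spoke-tail : ∀ {x} j → x ∈S spoke j → tail x ≡ unit j
  spoke-tail j (inj₁ refl) = refl
  spoke-tail j (inj₂ refl) = refl

  on-spoke : ∀ b j → Removed spokes (b ∷ unit j)
  on-spoke false j = Any.tabulate⁺ j (inj₁ refl)
  on-spoke true  j = Any.tabulate⁺ j (inj₂ refl)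

  spokes-disjoint : PairwiseDisjoint spokes
  spokes-disjoint = AllPairs.tabulate⁺ λ {i} {j} i≢j x x∈i x∈j →
    toggles-differ zeros i≢j (cong (λ w → lookup w i) (trans (sym (spoke-tail i x∈i)) (spoke-tail j x∈j)))

  axis-alive : ∀ b → ¬ Removed spokes (b ∷ zeros)
  axis-alive b removed =
    let j , x∈j = Any.tabulate⁻ {f = spoke} removed
    in toggle-differs j zeros (cong (λ w → lookup w j) (spoke-tail j x∈j))

  stays-on-axis : ∀ {x y k} → Walk spokes x y k → tail x ≡ zeros → tail y ≡ zeros
  stays-on-axis (here _) on-axis = on-axis
  stays-on-axis {b ∷ _} (step {v = x′} _ adj walk) refl with adj⇒toggle (b ∷ zeros) x′ adj
  ... | zero  , refl = stays-on-axis walk refl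
  ... | suc j , refl = ⊥-elim (walk-source-alive walk (on-spoke b j))

module _ (q : ℕ) where

  open Spokes (suc (suc q))

  ones : Vertex (3 + q)
  ones = replicate (3 + q) true

  ones-alive : ¬ Removed spokes ones
  ones-alive removed with Any.tabulate⁻ {f = spoke} removed
  ... | zero  , x∈j = case spoke-tail zero x∈j of λ ()
  ... | suc j , x∈j = case spoke-tail (suc j) x∈j of λ ()

  spokes-disconnect : Disconnects spokes
  spokes-disconnect = false ∷ zeros , ones , axis-alive false , ones-alive ,
                      λ (_ , walk) → case stays-on-axis walk refl of λ ()

κ≤n∸1 : ∀ {n κ} → 3 ≤ n → IsKappaS n κ → κ ≤ n ∸ 1
κ≤n∸1 {suc zero}              (s≤s ())       _
κ≤n∸1 {suc (suc zero)}        (s≤s (s≤s ())) _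
κ≤n∸1 {suc (suc (suc q))} {κ} _              isκ =
  subst (κ ≤_) (length-tabulate spoke) (κ≤length isκ spokes spokes-disjoint (spokes-disconnect q))
  where open Spokes (2 + q)

lemma3p5 : ∀ (n : ℕ) → 4 ≤ n → ∀ (κ : ℕ) → IsKappaS n κ →
    ∀ (F : List (Q1Sub n)) → PairwiseDisjoint F → length F ≤ κ ∸ 1 →
    ∀ (u v : Vertex n) → ¬ Removed F u → ¬ Removed F v →
    ∃[ k ] (k ≤ suc n × Walk F u v k)
lemma3p5 n 4≤n κ isκ F _ |F|≤κ∸1 u v au av = Faults.diameter≤1+n F 2+|F|≤n au av
  where
  open ≤-Reasoning
  2+|F|≤n : 2 + length F ≤ n
  2+|F|≤n = begin
    2 + length F      ≤⟨ +-monoʳ-≤ 2 |F|≤κ∸1 ⟩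
    2 + (κ ∸ 1)       ≤⟨ +-monoʳ-≤ 2 (∸-monoˡ-≤ 1 (κ≤n∸1 (≤-trans (n≤1+n 3) 4≤n) isκ)) ⟩
    2 + (n ∸ 1 ∸ 1)   ≡⟨ cong (2 +_) (∸-+-assoc n 1 1) ⟩
    2 + (n ∸ 2)       ≡⟨ m+[n∸m]≡n (≤-trans (s≤s (s≤s z≤n)) 4≤n) ⟩
    n                 ∎
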